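{- Let $B$ be a read-once branching program of width $3$ whose first and last layers have width $2$, which has at least one colliding layer, and which has no redundant vertices. Let $v_{1,1},v_{1,2}$ be its two start vertices. Then there exists an input string on which the two computation paths starting from $v_{1,1}$ and from $v_{1,2}$ collide (i.e. reach the same vertex in some layer).
   Context: Here a read-once branching program is a layered directed graph in which each layer has at most $3$ vertices, each vertex (except in the last layer) has exactly two outgoing edges into the next layer, one labeled $1$ and one labeled $-1$, and the $i$-th layer of edges is followed according to the $i$-th input bit; the first layer consists of two start vertices. A layer of edges is colliding if two edges with the same label enter the same vertex of the next layer. Two vertices in the same layer are locally equivalent if their $1$-edges reach the same vertex and their $(-1)$-edges reach the same vertex. The program has no redundant vertices if every vertex is reachable (from one of the start vertices) and no two vertices are locally equivalent. -}

module Defs where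

open import Data.Nat using (ℕ; zero; suc; _≤_; _<_)
open import Data.Fin using (Fin)
open import Data.Product using (Σ; ∃; _×_; ∃-syntax)
open import Relation.Binary.PropositionalEquality using (_≡_; _≢_)
open import Relation.Nullary using (¬_)

-- Edge labels 1 and -1.
data Sign : Set where
  plus  : Sign
  minus : Sign

-- A layered read-once branching program with vertex layers 0 .. len
-- (so len layers of edges).  For i < len, edge i v s is the endpoint in layer
-- (suc i) of the edge labelled s leaving vertex v of layer i.
-- Values of width / edge at indices beyond len are irrelevant junk:
-- every property below only looks at layers i ≤ len (edge layers i < len).
record BP : Set where
  field
    len   : ℕ
    width : ℕ → ℕ
    edge  : (i : ℕ) → Fin (width i) → Sign → Fin (width (suc i))

  -- Computation path from start vertex v (layer 0) on input x:
  -- the i-th layer of edges is followed according to the i-th input bit x i.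
  -- (Only x 0, ..., x (len - 1) influence layers 0 .. len.)
  run : (ℕ → Sign) → Fin (width 0) → (i : ℕ) → Fin (width i)
  run x v zero    = v
  run x v (suc i) = edge i (run x v i) (x i)

  WidthAtMost3 : Set
  WidthAtMost3 = ∀ i → i ≤ len → width i ≤ 3

  Colliding : (i : ℕ) → Set
  Colliding i = ∃[ u ] ∃[ v ] ∃[ s ] (u ≢ v × edge i u s ≡ edge i v s)

  HasCollidingLayer : Set
  HasCollidingLayer = ∃[ i ] (i < len × Colliding i)

  Reachable : (i : ℕ) → Fin (width i) → Set
  Reachable i v = ∃[ s ] ∃[ x ] (run x s i ≡ v)

  LocallyEquivalent : (i : ℕ) → Fin (width i) → Fin (width i) → Set
  LocallyEquivalent i u v = (s : Sign) → edge i u s ≡ edge i v s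

  NoRedundantVertices : Set
  NoRedundantVertices =
    (∀ i → i ≤ len → (v : Fin (width i)) → Reachable i v) ×
    (∀ i → i < len → (u v : Fin (width i)) → u ≢ v → ¬ LocallyEquivalent i u v)

  PathsCollide : (ℕ → Sign) → Fin (width 0) → Fin (width 0) → Set
  PathsCollide x a b = ∃[ i ] (i ≤ len × run x a i ≡ run x b i)

-- Take a colliding layer i: two distinct vertices u, v whose s-edges enter the same vertex.
-- Reach u and v from start vertices, on inputs x and y, and look where the other start vertex
-- is sent by the same inputs. If that vertex is u or v, setting bit i to s makes the two
-- start paths collide. Otherwise both land outside {u, v}, hence on the same vertex, because
-- the layer has at most 3 vertices. So two start paths (one under x, one under y) meet
-- while the remaining two are apart. Since no two vertices are locally equivalent, the
-- remaining two can be kept apart layer by layer by extending x and y by the same bit,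
-- while the meeting paths stay together. In the last layer, of width 2, this gives three
-- vertices of which two are distinct and the third must equal one of them: a collision
-- of the two start paths under x or under y.
module Submission where

open import Defs
open import Data.Nat using (ℕ; _≤_; _<_)
open import Data.Fin using (Fin)
open import Data.Product using (_×_; ∃-syntax)
open import Relation.Binary.PropositionalEquality using (_≡_; _≢_)

open import Data.Nat as ℕ using (zero; suc; s≤s; _≤‴_; ≤‴-refl; ≤‴-step)
open import Data.Nat.Properties using (≤-refl; ≤-reflexive; <⇒≤; m<n⇒m<1+n; <-irrefl; ≤⇒≤‴; ≤‴⇒≤)
open import Data.Fin using (zero; suc)
open import Data.Fin.Properties using (punchOut-injective) renaming (_≟_ to _≟ᶠ_)
open import Data.Product using (_,_; proj₁; proj₂)
open import Data.Sum using (_⊎_; inj₁; inj₂)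
open import Data.Empty using (⊥-elim)
open import Function using (_∘_)
open import Relation.Nullary using (yes; no)
open import Relation.Binary.PropositionalEquality
  using (refl; sym; trans; cong; cong₂; subst₂; ≢-sym; module ≡-Reasoning)

≤1⇒all-equal : ∀ {n} → n ≤ 1 → (r t : Fin n) → r ≡ t
≤1⇒all-equal (s≤s ℕ.z≤n) zero zero = refl

≤2⇒unique-avoiding : ∀ {n} → n ≤ 2 → {p r t : Fin n} → p ≢ r → p ≢ t → r ≡ t
≤2⇒unique-avoiding {suc m} (s≤s m≤1) p≢r p≢t =
  punchOut-injective p≢r p≢t (≤1⇒all-equal m≤1 _ _)

≤3⇒unique-avoiding-both : ∀ {n} → n ≤ 3 → {p q r t : Fin n} → p ≢ q →
                          p ≢ r → q ≢ r → p ≢ t → q ≢ t → r ≡ t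
≤3⇒unique-avoiding-both {suc m} (s≤s m≤2) p≢q p≢r q≢r p≢t q≢t =
  punchOut-injective p≢r p≢t
    (≤2⇒unique-avoiding m≤2 (q≢r ∘ punchOut-injective p≢q p≢r)
                            (q≢t ∘ punchOut-injective p≢q p≢t))

another : ∀ {n} {a b : Fin n} → a ≢ b → (c : Fin n) → ∃[ d ] (c ≢ d)
another {a = a} {b} a≢b c with c ≟ᶠ a
... | yes refl = b , a≢b
... | no c≢a   = a , c≢a

_[_]≔_ : {A : Set} → (ℕ → A) → ℕ → A → ℕ → A
(x [ k ]≔ s) j with j ℕ.≟ k
... | yes _ = s
... | no _  = x j

[]≔-updated : ∀ {A : Set} (x : ℕ → A) k s → (x [ k ]≔ s) k ≡ s
[]≔-updated x k s with k ℕ.≟ k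
... | yes _  = refl
... | no k≢k = ⊥-elim (k≢k refl)

[]≔-below : ∀ {A : Set} (x : ℕ → A) {k} s {j} → j < k → (x [ k ]≔ s) j ≡ x j
[]≔-below x {k} s {j} j<k with j ℕ.≟ k
... | yes refl = ⊥-elim (<-irrefl refl j<k)
... | no _     = refl

module _ (B : BP) where
  open BP B

  run-cong : ∀ {x y} c k → (∀ {j} → j < k → x j ≡ y j) → run x c k ≡ run y c k
  run-cong c zero    x≗y = refl
  run-cong c (suc k) x≗y =
    cong₂ (edge k) (run-cong c k (x≗y ∘ m<n⇒m<1+n)) (x≗y ≤-refl)

  run-[]≔ : ∀ x k s c → run (x [ k ]≔ s) c (suc k) ≡ edge k (run x c k) s
  run-[]≔ x k s c
    rewrite []≔-updated x k s | run-cong {x [ k ]≔ s} {x} c k ([]≔-below x s) = refl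

  run-[]≔-merge : ∀ {x c d k s} → edge k (run x c k) s ≡ edge k (run x d k) s →
                  run (x [ k ]≔ s) c (suc k) ≡ run (x [ k ]≔ s) d (suc k)
  run-[]≔-merge {x} {c} {d} {k} {s} e = begin
    run (x [ k ]≔ s) c (suc k) ≡⟨ run-[]≔ x k s c ⟩
    edge k (run x c k) s       ≡⟨ e ⟩
    edge k (run x d k) s       ≡⟨ sym (run-[]≔ x k s d) ⟩
    run (x [ k ]≔ s) d (suc k) ∎
    where open ≡-Reasoning

  StartPathsCollide : Set
  StartPathsCollide = ∃[ x ] ∃[ c ] ∃[ d ] (c ≢ d × PathsCollide x c d)

  PathsCollide-sym : ∀ {x c d} → PathsCollide x c d → PathsCollide x d c
  PathsCollide-sym (i , i≤len , e) = i , i≤len , sym e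

  start-paths-collide⇒ : width 0 ≤ 2 → {a b : Fin (width 0)} → a ≢ b →
                         StartPathsCollide → ∃[ x ] PathsCollide x a b
  start-paths-collide⇒ w₀≤2 {a} {b} a≢b (x , c , d , c≢d , collide) with c ≟ᶠ a
  ... | yes refl = x , subst₂ (PathsCollide x) refl (≤2⇒unique-avoiding w₀≤2 c≢d a≢b) collide
  ... | no c≢a   = x , PathsCollide-sym (subst₂ (PathsCollide x)
                         (≤2⇒unique-avoiding w₀≤2 (≢-sym c≢a) a≢b)
                         (≤2⇒unique-avoiding w₀≤2 c≢d c≢a) collide)

  separating-sign : NoRedundantVertices → ∀ {k} → k < len →
                    {p q : Fin (width k)} → p ≢ q → ∃[ s ] (edge k p s ≢ edge k q s)
  separating-sign (_ , distinguishable) {k} k<len {p} {q} p≢q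
    with edge k p plus ≟ᶠ edge k q plus | edge k p minus ≟ᶠ edge k q minus
  ... | no ≢₊   | _       = plus , ≢₊
  ... | yes _   | no ≢₋   = minus , ≢₋
  ... | yes ≡₊  | yes ≡₋  = ⊥-elim (distinguishable k k<len p q p≢q λ { plus → ≡₊ ; minus → ≡₋ })

  record Fork (k : ℕ) : Set where
    constructor mkFork
    field
      x₁ x₂       : ℕ → Sign
      c₁ d₁ c₂ d₂ : Fin (width 0)
      c₁≢d₁       : c₁ ≢ d₁
      c₂≢d₂       : c₂ ≢ d₂
      meet        : run x₁ c₁ k ≡ run x₂ c₂ k
      apart       : run x₁ d₁ k ≢ run x₂ d₂ k

  fork-step : NoRedundantVertices → ∀ {k} → k < len → Fork k → Fork (suc k)
  fork-step nr {k} k<len f = record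
    { x₁    = x₁ [ k ]≔ s
    ; x₂    = x₂ [ k ]≔ s
    ; c₁≢d₁ = c₁≢d₁
    ; c₂≢d₂ = c₂≢d₂
    ; meet  = begin
        run (x₁ [ k ]≔ s) c₁ (suc k) ≡⟨ run-[]≔ x₁ k s c₁ ⟩
        edge k (run x₁ c₁ k) s       ≡⟨ cong (λ v → edge k v s) meet ⟩
        edge k (run x₂ c₂ k) s       ≡⟨ sym (run-[]≔ x₂ k s c₂) ⟩
        run (x₂ [ k ]≔ s) c₂ (suc k) ∎
    ; apart = λ e → edges-apart
        (trans (sym (run-[]≔ x₁ k s d₁)) (trans e (run-[]≔ x₂ k s d₂)))
    }
    where
    open Fork f
    open ≡-Reasoning
    s = proj₁ (separating-sign nr k<len apart)
    edges-apart = proj₂ (separating-sign nr k<len apart)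

  fork-extend : NoRedundantVertices → ∀ {k} → k ≤‴ len → Fork k → Fork len
  fork-extend nr ≤‴-refl             f = f
  fork-extend nr (≤‴-step k<‴len) f =
    fork-extend nr k<‴len (fork-step nr (≤‴⇒≤ k<‴len) f)

  fork-at-end : width len ≤ 2 → Fork len → StartPathsCollide
  fork-at-end wₗ≤2 (mkFork x₁ x₂ c₁ d₁ c₂ d₂ c₁≢d₁ c₂≢d₂ meet apart)
    with run x₁ d₁ len ≟ᶠ run x₁ c₁ len | run x₂ d₂ len ≟ᶠ run x₂ c₂ len
  ... | yes e | _     = x₁ , d₁ , c₁ , ≢-sym c₁≢d₁ , len , ≤-refl , e
  ... | no _  | yes e = x₂ , d₂ , c₂ , ≢-sym c₂≢d₂ , len , ≤-refl , e
  ... | no ≢₁ | no ≢₂ =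
    ⊥-elim (≢₂ (trans (sym (≤2⇒unique-avoiding wₗ≤2 ≢₁ apart)) meet))

  avoids-or-collides : ∀ {i} → i < len → ∀ {u v s} → edge i u s ≡ edge i v s →
                       ∀ {x c d} → c ≢ d → run x c i ≡ u →
                       StartPathsCollide ⊎ (u ≢ run x d i × v ≢ run x d i)
  avoids-or-collides {i} i<len {u} {v} {s} uₛ≡vₛ {x} {c} {d} c≢d refl
    with run x c i ≟ᶠ run x d i | v ≟ᶠ run x d i
  ... | yes e | _     = inj₁ (x , c , d , c≢d , i , <⇒≤ i<len , e)
  ... | no _  | yes e = inj₁ (x [ i ]≔ s , c , d , c≢d , suc i , i<len ,
                               run-[]≔-merge (trans uₛ≡vₛ (cong (λ w → edge i w s) e)))
  ... | no ≢u | no ≢v = inj₂ (≢u , ≢v)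

  collision⇒fork : WidthAtMost3 → NoRedundantVertices → {a b : Fin (width 0)} → a ≢ b →
                   ∀ {i} → i < len → Colliding i → StartPathsCollide ⊎ Fork i
  collision⇒fork w3 (reachable , _) a≢b {i} i<len (u , v , s , u≢v , uₛ≡vₛ)
    with reachable i (<⇒≤ i<len) u | reachable i (<⇒≤ i<len) v
  ... | cᵤ , xᵤ , eᵤ | cᵥ , xᵥ , eᵥ
    with another a≢b cᵤ | another a≢b cᵥ
  ... | dᵤ , cᵤ≢dᵤ | dᵥ , cᵥ≢dᵥ
    with avoids-or-collides i<len uₛ≡vₛ cᵤ≢dᵤ eᵤ | avoids-or-collides i<len (sym uₛ≡vₛ) cᵥ≢dᵥ eᵥ
  ... | inj₁ collide | _            = inj₁ collide
  ... | inj₂ _       | inj₁ collide = inj₁ collide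
  ... | inj₂ (u≢tᵤ , v≢tᵤ) | inj₂ (v≢tᵥ , u≢tᵥ) = inj₂ (record
    { x₁ = xᵤ ; x₂ = xᵥ ; c₁ = dᵤ ; d₁ = cᵤ ; c₂ = dᵥ ; d₂ = cᵥ
    ; c₁≢d₁ = ≢-sym cᵤ≢dᵤ
    ; c₂≢d₂ = ≢-sym cᵥ≢dᵥ
    ; meet  = ≤3⇒unique-avoiding-both (w3 i (<⇒≤ i<len)) u≢v u≢tᵤ v≢tᵤ u≢tᵥ v≢tᵥ
    ; apart = λ e → u≢v (trans (sym eᵤ) (trans e eᵥ))
    })

claim7p6 : (B : BP) → let open BP B in
    WidthAtMost3 → width 0 ≡ 2 → width len ≡ 2 →
    HasCollidingLayer → NoRedundantVertices →
    (v₁₁ v₁₂ : Fin (width 0)) → v₁₁ ≢ v₁₂ →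
    ∃[ x ] PathsCollide x v₁₁ v₁₂
claim7p6 B w3 w₀ wₗ (i , i<len , colliding) nr v₁₁ v₁₂ v₁₁≢v₁₂ =
  start-paths-collide⇒ B (≤-reflexive w₀) v₁₁≢v₁₂ start-collision
  where
  start-collision : StartPathsCollide B
  start-collision with collision⇒fork B w3 nr v₁₁≢v₁₂ i<len colliding
  ... | inj₁ collide = collide
  ... | inj₂ fork    = fork-at-end B (≤-reflexive wₗ) (fork-extend B nr (≤⇒≤‴ (<⇒≤ i<len)) fork)
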